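{- Let $I$ be a finite set, $C$ a simplicial complex on $I$, and $g$ its 1-skeleton. Then $\chi^{SC}_I(C)$ is the chromatic polynomial of $g$; i.e. for every positive integer $n$, $\chi^{SC}_I(C)(n)$ is the number of maps $I\to[n]$ such that the two vertices of every edge of $g$ receive different values.
   Context: A simplicial complex on $I$ is a collection $C$ of subsets of $I$ (faces) such that $J\in C$ and $K\subseteq J$ imply $K\in C$. Its 1-skeleton is the graph on $I$ whose edges are the faces of cardinality $2$. The Hopf monoid $SC$: for $I=S\sqcup T$, the product is union and the coproduct is $C\mapsto C|_S\otimes C/_S$ with $C|_S=\{J\in C: J\subseteq S\}$ and $C/_S=\{J\cap T: J\in C,\ J\not\subseteq S\}\cup\{\emptyset\}$ (without repetition). For a decomposition $(S_1,\dots,S_n)$ of $I$ (pairwise disjoint, possibly empty subsets with union $I$), $\Delta_{S_1,\dots,S_n}$ is the iterated coproduct. The basic invariant is $\chi^{SC}_I(C)(n)=$ number of decompositions $(S_1,\dots,S_n)$ of $I$ of length $n$ such that every tensor factor of $\Delta_{S_1,\dots,S_n}(C)$ is discrete, i.e. has only faces of cardinality at most $1$. -}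

module Defs where

open import Data.Bool using (Bool; true; false; _∧_; _∨_; not; if_then_else_)
open import Data.Nat using (ℕ; zero; suc; _≤ᵇ_; _≡ᵇ_)
open import Data.Fin using (Fin; zero; suc)
open import Data.Fin.Properties using (_≟_)
open import Data.Fin.Subset using (Subset; ⊥; ⁅_⁆; _∪_; _∩_; ∁; ∣_∣)
open import Data.Vec using (Vec; []; _∷_; lookup; zipWith)
open import Data.List using (List; []; _∷_; map; concatMap; filterᵇ; length; allFin)
open import Data.Bool.ListAction using (all; any)
open import Relation.Nullary.Decidable using (⌊_⌋)
open import Relation.Binary.PropositionalEquality using (_≡_)

allSubsets : (m : ℕ) → List (Subset m)
allSubsets zero    = [] ∷ []
allSubsets (suc m) = concatMap (λ s → (false ∷ s) ∷ (true ∷ s) ∷ []) (allSubsets m)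

_⊆ᵇ_ : ∀ {m} → Subset m → Subset m → Bool
[]      ⊆ᵇ []      = true
(a ∷ J) ⊆ᵇ (b ∷ K) = (not a ∨ b) ∧ (J ⊆ᵇ K)

_≟ˢ_ : ∀ {m} → Subset m → Subset m → Bool
J ≟ˢ K = (J ⊆ᵇ K) ∧ (K ⊆ᵇ J)

record SimplicialComplex (m : ℕ) : Set where
  field
    face     : Subset m → Bool
    downward : ∀ J K → (K ⊆ᵇ J) ≡ true → face J ≡ true → face K ≡ true
open SimplicialComplex public

-- A "complex" as a mere collection of subsets of Fin m (characteristic function).
-- The ground set of each tensor factor is implicit: all its faces lie in it.
Collection : ℕ → Set
Collection m = Subset m → Bool

restrict : ∀ {m} → Collection m → Subset m → Collection m
restrict C S J = C J ∧ (J ⊆ᵇ S)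

-- Contraction C/_S = { J ∩ T : J ∈ C, J ⊄ S } ∪ {∅}, with T the complement of S
-- in the ground set of C (since faces of C lie in its ground set, J ∩ T = J ∩ ∁ S).
contract : ∀ {m} → Collection m → Subset m → Collection m
contract {m} C S K =
  (K ≟ˢ ⊥) ∨ any (λ J → C J ∧ not (J ⊆ᵇ S) ∧ ((J ∩ ∁ S) ≟ˢ K)) (allSubsets m)

-- Tensor factors of the iterated coproduct Δ_{S₁,…,Sₙ}(C)
--   = C|_{S₁} ⊗ Δ_{S₂,…,Sₙ}(C/_{S₁}).
factors : ∀ {m} → Collection m → List (Subset m) → List (Collection m)
factors C []       = []
factors C (S ∷ Ss) = restrict C S ∷ factors (contract C S) Ss

discrete : ∀ {m} → Collection m → Bool
discrete {m} D = all (λ J → not (D J) ∨ (∣ J ∣ ≤ᵇ 1)) (allSubsets m)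

-- A decomposition (S₁,…,Sₙ) of Fin m of length n is encoded by the map
-- f : Fin m → Fin n (given as a vector) with S_i = f⁻¹(i).
allMaps : (m n : ℕ) → List (Vec (Fin n) m)
allMaps zero    n = [] ∷ []
allMaps (suc m) n = concatMap (λ v → map (λ i → i ∷ v) (allFin n)) (allMaps m n)

block : ∀ {m n} → Vec (Fin n) m → Fin n → Subset m
block []      i = []
block (x ∷ f) i = ⌊ x ≟ i ⌋ ∷ block f i

blocks : ∀ {m n} → Vec (Fin n) m → List (Subset m)
blocks {n = n} f = map (block f) (allFin n)

χSC : ∀ {m} → SimplicialComplex m → ℕ → ℕ
χSC {m} C n =
  length (filterᵇ (λ f → all discrete (factors (face C) (blocks f))) (allMaps m n))

adjacent : ∀ {m} → SimplicialComplex m → Fin m → Fin m → Bool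
adjacent C x y = not ⌊ x ≟ y ⌋ ∧ face C (⁅ x ⁆ ∪ ⁅ y ⁆)

proper : ∀ {m n} → SimplicialComplex m → Vec (Fin n) m → Bool
proper {m} C f =
  all (λ x → all (λ y → not (adjacent C x y) ∨ not ⌊ lookup f x ≟ lookup f y ⌋)
                 (allFin m))
      (allFin m)

chromatic : ∀ {m} → SimplicialComplex m → ℕ → ℕ
chromatic {m} C n = length (filterᵇ (λ f → proper C f) (allMaps m n))

{-# OPTIONS --safe #-}
-- A decomposition of length n is a colouring f, its blocks being the colour classes.
-- Every nonempty face of an iterated contraction of C lies inside a face of C, so its
-- vertices are pairwise adjacent in the 1-skeleton; hence for a proper colouring every
-- restriction to a colour class is discrete. Conversely, an edge whose two ends get the
-- same colour c is disjoint from the other classes, survives their contractions, and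
-- makes the restriction to class c non-discrete.
module Submission where

open import Data.Bool using (true; false; T; not; _∧_; _∨_)
open import Data.Bool.Properties using (T-≡; T-∧; T-∨)
open import Data.Bool.ListAction using (all)
open import Data.Empty using (⊥-elim)
open import Data.Fin using (Fin; zero; suc)
open import Data.Fin.Properties using (_≟_)
open import Data.Fin.Subset
  using (Subset; _∈_; _∉_; _⊆_; ⁅_⁆; _∪_; _∩_; ∁; ∣_∣; Nonempty)
open import Data.Fin.Subset.Properties
  using ( drop-∷-⊆; x∈⁅x⁆; x∈⁅y⁆⇒x≡y; x≢y⇒x∉⁅y⁆; ∣⁅x⁆∣≡1; ∣⊥∣≡0; ∉⊥; Empty-unique
        ; nonempty?; p⊆q⇒∣p∣≤∣q∣; p⊂q⇒∣p∣<∣q∣; x∈p∪q⁺; x∈p∪q⁻; x∈p∩q⁺; x∈p∩q⁻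
        ; x∉p⇒x∈∁p )
open import Data.List using ([]; _∷_; map; length; allFin)
open import Data.List.Membership.Propositional using () renaming (_∈_ to _∈ₗ_)
open import Data.List.Membership.Propositional.Properties using (∈-concatMap⁺; ∈-allFin)
open import Data.List.Properties using (filter-≐)
import Data.List.Relation.Unary.All as All
open import Data.List.Relation.Unary.All.Properties using (all⁺; all⁻)
open import Data.List.Relation.Unary.Any as Any using (here; there)
open import Data.List.Relation.Unary.Any.Properties using (any⁺; any⁻)
open import Data.Nat using (ℕ; _≤_; _<_; z≤n)
open import Data.Nat.Properties using (≤ᵇ⇒≤; ≤⇒≤ᵇ; <⇒≱)
open import Data.Product using (∃-syntax; _×_; _,_; proj₁; proj₂)
open import Data.Sum using (inj₁; inj₂)
open import Data.Vec using (Vec; []; _∷_; lookup)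
open import Data.Vec.Base using (here; there)
open import Function using (_∘_; _⇔_; mk⇔; Equivalence)
open import Relation.Binary.PropositionalEquality using (_≡_; _≢_; refl; sym; trans; subst; cong)
open import Relation.Nullary using (¬_; yes; no)
open import Relation.Nullary.Decidable using (T?; decidable-stable; toWitnessFalse; fromWitnessFalse)

open import Defs

open Equivalence using (to; from)

private variable
  m n : ℕ
  x y : Fin m
  i c : Fin n
  p J K S : Subset m
  D : Collection m

T-not-∨ : ∀ {a b} → T (not a ∨ b) ⇔ (T a → T b)
T-not-∨ {true}  = mk⇔ (λ tb _ → tb) (λ f → f _)
T-not-∨ {false} = mk⇔ (λ _ ()) (λ _ → _)

¬T⇒T-not : ∀ {b} → ¬ T b → T (not b)
¬T⇒T-not {true}  ¬tb = ¬tb _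
¬T⇒T-not {false} _   = _

⊆ᵇ⇒⊆ : T (J ⊆ᵇ K) → J ⊆ K
⊆ᵇ⇒⊆ {J = _ ∷ _} {true  ∷ _} _  here = here
⊆ᵇ⇒⊆ {J = _ ∷ _} {false ∷ _} () here
⊆ᵇ⇒⊆ {J = a ∷ _} {b ∷ _} J⊆ᵇK (there x∈J) =
  there (⊆ᵇ⇒⊆ (proj₂ (to (T-∧ {not a ∨ b}) J⊆ᵇK)) x∈J)

⊆⇒⊆ᵇ : J ⊆ K → T (J ⊆ᵇ K)
⊆⇒⊆ᵇ {J = []}        {[]}    _   = _
⊆⇒⊆ᵇ {J = false ∷ _} {_ ∷ _} J⊆K = ⊆⇒⊆ᵇ (drop-∷-⊆ J⊆K)
⊆⇒⊆ᵇ {J = true  ∷ _} {_ ∷ _} J⊆K with J⊆K here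
... | here = ⊆⇒⊆ᵇ (drop-∷-⊆ J⊆K)

∈-allSubsets : (J : Subset m) → J ∈ₗ allSubsets m
∈-allSubsets []      = here refl
∈-allSubsets (b ∷ J) = ∈-concatMap⁺ _ (Any.map (λ { refl → extend b }) (∈-allSubsets J))
  where
  extend : ∀ b → b ∷ J ∈ₗ (false ∷ J) ∷ (true ∷ J) ∷ []
  extend false = here refl
  extend true  = there (here refl)

∣p∣≤1 : {p : Subset m} → (∀ {x y} → x ∈ p → y ∈ p → x ≡ y) → ∣ p ∣ ≤ 1
∣p∣≤1 {m} {p} subsingleton with nonempty? p
... | yes (x , x∈p) =
  subst (∣ p ∣ ≤_) (∣⁅x⁆∣≡1 x)
    (p⊆q⇒∣p∣≤∣q∣ λ y∈p → subst (_∈ ⁅ x ⁆) (subsingleton x∈p y∈p) (x∈⁅x⁆ x))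
... | no empty rewrite Empty-unique empty = subst (_≤ 1) (sym (∣⊥∣≡0 m)) z≤n

1<∣p∣ : x ∈ p → y ∈ p → x ≢ y → 1 < ∣ p ∣
1<∣p∣ {x = x} {p = p} {y = y} x∈p y∈p x≢y =
  subst (_< ∣ p ∣) (∣⁅x⁆∣≡1 x) (p⊂q⇒∣p∣<∣q∣ (⁅x⁆⊆p , y , y∈p , x≢y⇒x∉⁅y⁆ (x≢y ∘ sym)))
  where
  ⁅x⁆⊆p : ⁅ x ⁆ ⊆ p
  ⁅x⁆⊆p z∈⁅x⁆ = subst (_∈ p) (sym (x∈⁅y⁆⇒x≡y x z∈⁅x⁆)) x∈p

pair : Fin m → Fin m → Subset m
pair x y = ⁅ x ⁆ ∪ ⁅ y ⁆

x∈pair : x ∈ pair x y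
x∈pair {x = x} = x∈p∪q⁺ (inj₁ (x∈⁅x⁆ x))

y∈pair : y ∈ pair x y
y∈pair {y = y} = x∈p∪q⁺ (inj₂ (x∈⁅x⁆ y))

pair⊆ : x ∈ p → y ∈ p → pair x y ⊆ p
pair⊆ {x = x} {y = y} x∈p y∈p z∈pair with x∈p∪q⁻ ⁅ x ⁆ ⁅ y ⁆ z∈pair
... | inj₁ z∈⁅x⁆ rewrite x∈⁅y⁆⇒x≡y x z∈⁅x⁆ = x∈p
... | inj₂ z∈⁅y⁆ rewrite x∈⁅y⁆⇒x≡y y z∈⁅y⁆ = y∈p

∈-block⁺ : (f : Vec (Fin n) m) {x : Fin m} {i : Fin n} → lookup f x ≡ i → x ∈ block f i
∈-block⁺ (a ∷ f) {zero} refl with a ≟ a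
... | yes _   = here
... | no a≢a  = ⊥-elim (a≢a refl)
∈-block⁺ (a ∷ f) {suc x} fx≡i = there (∈-block⁺ f fx≡i)

∈-block⁻ : (f : Vec (Fin n) m) {x : Fin m} {i : Fin n} → x ∈ block f i → lookup f x ≡ i
∈-block⁻ (a ∷ f) {zero} {i} x∈block with a ≟ i | x∈block
... | yes a≡i | _ = a≡i
... | no _    | ()
∈-block⁻ (a ∷ f) {suc x} (there x∈block) = ∈-block⁻ f x∈block

restrict⁺ : T (D J) → J ⊆ S → T (restrict D S J)
restrict⁺ DJ J⊆S = from T-∧ (DJ , ⊆⇒⊆ᵇ J⊆S)

restrict⁻ : T (restrict D S J) → T (D J) × J ⊆ S
restrict⁻ {D = D} {J = J} DJ∧J⊆S with to (T-∧ {D J}) DJ∧J⊆S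
... | DJ , J⊆ᵇS = DJ , ⊆ᵇ⇒⊆ J⊆ᵇS

-- The empty face is the only one that the contraction adds.
contract-face⁻ : T (contract D S K) → Nonempty K → ∃[ J ] T (D J) × K ⊆ J
contract-face⁻ {D = D} {S = S} {K = K} DK (x , x∈K) with to (T-∨ {K ≟ˢ _}) DK
... | inj₁ K≡∅ = ⊥-elim (∉⊥ (⊆ᵇ⇒⊆ (proj₁ (to (T-∧ {K ⊆ᵇ _}) K≡∅)) x∈K))
... | inj₂ DJ-witness with Any.satisfied (any⁻ _ (allSubsets _) DJ-witness)
... | J , DJ∧J⊈S∧K≡J-S with to (T-∧ {D J}) DJ∧J⊈S∧K≡J-S
... | DJ , J⊈S∧K≡J-S =
  J , DJ , λ z∈K → proj₁ (x∈p∩q⁻ J (∁ S) (⊆ᵇ⇒⊆ K⊆J-S z∈K))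
  where
  K⊆J-S : T (K ⊆ᵇ (J ∩ ∁ S))
  K⊆J-S = proj₂ (to T-∧ (proj₂ (to (T-∧ {not (J ⊆ᵇ S)}) J⊈S∧K≡J-S)))

contract-face⁺ : T (D K) → Nonempty K → (∀ {z} → z ∈ K → z ∉ S) → T (contract D S K)
contract-face⁺ {D = D} {K = K} {S = S} DK (x , x∈K) K-disjoint-S =
  from (T-∨ {K ≟ˢ _}) (inj₂ (any⁺ _ (Any.map (λ { refl → K-survives }) (∈-allSubsets K))))
  where
  K⊈S : ¬ T (K ⊆ᵇ S)
  K⊈S K⊆S = K-disjoint-S x∈K (⊆ᵇ⇒⊆ K⊆S x∈K)
  K-survives : T (D K ∧ not (K ⊆ᵇ S) ∧ ((K ∩ ∁ S) ≟ˢ K))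
  K-survives = from T-∧ (DK , from T-∧ (¬T⇒T-not K⊈S , from T-∧
    ( ⊆⇒⊆ᵇ (λ {z} z∈K-S → proj₁ (x∈p∩q⁻ K (∁ S) z∈K-S))
    , ⊆⇒⊆ᵇ (λ z∈K → x∈p∩q⁺ (z∈K , x∉p⇒x∈∁p (K-disjoint-S z∈K))))))

discrete⁺ : (∀ J → T (D J) → ∣ J ∣ ≤ 1) → T (discrete D)
discrete⁺ small =
  all⁻ _ {xs = allSubsets _} (All.tabulate λ {J} _ → from T-not-∨ (≤⇒≤ᵇ ∘ small J))

discrete⁻ : T (discrete D) → T (D J) → ∣ J ∣ ≤ 1
discrete⁻ {J = J} disc DJ =
  ≤ᵇ⇒≤ _ _ (to T-not-∨ (All.lookup (all⁺ _ _ disc) (∈-allSubsets J)) DJ)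

module _ (C : SimplicialComplex m) where

  adjacent⁺ : x ≢ y → T (face C (pair x y)) → T (adjacent C x y)
  adjacent⁺ x≢y Cxy = from T-∧ (fromWitnessFalse x≢y , Cxy)

  adjacent⁻ : T (adjacent C x y) → x ≢ y × T (face C (pair x y))
  adjacent⁻ adj = let x≢y , Cxy = to T-∧ adj in toWitnessFalse x≢y , Cxy

  FacesAreCliques : Collection m → Set
  FacesAreCliques D = ∀ {K x y} → T (D K) → x ∈ K → y ∈ K → x ≢ y → T (adjacent C x y)

  facesAreCliques : FacesAreCliques (face C)
  facesAreCliques {K} {x} {y} CK x∈K y∈K x≢y =
    adjacent⁺ x≢y (from T-≡ (downward C K (pair x y) (to T-≡ (⊆⇒⊆ᵇ (pair⊆ x∈K y∈K))) (to T-≡ CK)))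

  facesAreCliques-contract : FacesAreCliques D → FacesAreCliques (contract D S)
  facesAreCliques-contract cliques DK x∈K y∈K x≢y with contract-face⁻ DK (_ , x∈K)
  ... | J , DJ , K⊆J = cliques DJ (K⊆J x∈K) (K⊆J y∈K) x≢y

  module _ (f : Vec (Fin n) m) where

    proper⁺ : (∀ x y → T (adjacent C x y) → lookup f x ≢ lookup f y) → T (proper C f)
    proper⁺ distinct-colours = all⁻ _ {xs = allFin m} (All.tabulate λ {x} _ →
      all⁻ _ {xs = allFin m} (All.tabulate λ {y} _ →
        from T-not-∨ (fromWitnessFalse ∘ distinct-colours x y)))

    proper⁻ : T (proper C f) → T (adjacent C x y) → lookup f x ≢ lookup f y
    proper⁻ {x = x} {y = y} f-proper adj = toWitnessFalse (to T-not-∨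
      (All.lookup (all⁺ _ _ (All.lookup (all⁺ _ _ f-proper) (∈-allFin x))) (∈-allFin y)) adj)

    proper⇒restrict-discrete : T (proper C f) → FacesAreCliques D →
                               T (discrete (restrict D (block f i)))
    proper⇒restrict-discrete {D = D} {i = i} f-proper cliques =
      discrete⁺ {D = restrict D (block f i)} λ J DJ∧J⊆block →
      let DJ , J⊆block = restrict⁻ {D = D} DJ∧J⊆block in
      ∣p∣≤1 λ x∈J y∈J → decidable-stable (_ ≟ _) λ x≢y →
        proper⁻ f-proper (cliques DJ x∈J y∈J x≢y)
          (trans (∈-block⁻ f (J⊆block x∈J)) (sym (∈-block⁻ f (J⊆block y∈J))))

    proper⇒factors-discrete : T (proper C f) → FacesAreCliques D →
                              ∀ is → T (all discrete (factors D (map (block f) is)))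
    proper⇒factors-discrete f-proper cliques []       = _
    proper⇒factors-discrete f-proper cliques (i ∷ is) = from T-∧
      ( proper⇒restrict-discrete f-proper cliques
      , proper⇒factors-discrete f-proper (facesAreCliques-contract cliques) is )

    monochromatic⇒restrict-not-discrete : x ≢ y → T (D (pair x y)) → pair x y ⊆ block f c →
                                          ¬ T (discrete (restrict D (block f c)))
    monochromatic⇒restrict-not-discrete {D = D} {c = c} x≢y Dxy xy⊆c disc =
      <⇒≱ (1<∣p∣ x∈pair y∈pair x≢y)
        (discrete⁻ {D = restrict D (block f c)} disc (restrict⁺ {D = D} Dxy xy⊆c))

    monochromatic⇒factors-not-discrete : x ≢ y → T (D (pair x y)) → pair x y ⊆ block f c →
      ∀ is → c ∈ₗ is → ¬ T (all discrete (factors D (map (block f) is)))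
    monochromatic⇒factors-not-discrete {x = x} {y = y} {D = D} {c = c}
      x≢y Dxy xy⊆c (i ∷ is) c∈i∷is all-disc with i ≟ c | to (T-∧ {discrete (restrict D (block f i))}) all-disc
    ... | yes refl | disc , _ = monochromatic⇒restrict-not-discrete x≢y Dxy xy⊆c disc
    ... | no i≢c   | _ , rest-disc with c∈i∷is
    ...   | here c≡i   = i≢c (sym c≡i)
    ...   | there c∈is = monochromatic⇒factors-not-discrete x≢y
            (contract-face⁺ {D = D} Dxy (_ , x∈pair) xy-disjoint-i) xy⊆c is c∈is rest-disc
      where
      xy-disjoint-i : ∀ {z} → z ∈ pair x y → z ∉ block f i
      xy-disjoint-i z∈xy z∈i = i≢c (trans (sym (∈-block⁻ f z∈i)) (∈-block⁻ f (xy⊆c z∈xy)))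

    factors-discrete⇔proper : T (all discrete (factors (face C) (blocks f))) ⇔ T (proper C f)
    factors-discrete⇔proper = mk⇔
      (λ all-disc → proper⁺ λ x y adj fx≡fy →
        let x≢y , Cxy = adjacent⁻ adj
            xy⊆block = pair⊆ (∈-block⁺ f refl) (∈-block⁺ f (sym fx≡fy))
        in monochromatic⇒factors-not-discrete x≢y Cxy xy⊆block (allFin n) (∈-allFin _) all-disc)
      (λ f-proper → proper⇒factors-discrete f-proper facesAreCliques (allFin n))

-- The identity holds for n = 0 as well.
mainTheorem7 : (m : ℕ) (C : SimplicialComplex m) (n : ℕ) → 1 ≤ n →
    χSC C n ≡ chromatic C n
mainTheorem7 m C n _ = cong length (filter-≐ (T? ∘ _) (T? ∘ _)
  ((λ {f} → to (factors-discrete⇔proper C f)) , (λ {f} → from (factors-discrete⇔proper C f)))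
  (allMaps m n))
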